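{- Let $M$ be a symmetric $(n+m)\times(n+m)$ matrix with entries in $\{0,1\}$ of the block form $M=\begin{bmatrix}A & C\\ C^T & B\end{bmatrix}$, where $A$ is a symmetric $n\times n$ matrix, $B$ is a symmetric $m\times m$ matrix and $C$ is an $n\times m$ staircase matrix. If $m\ge \mathrm{rank}(A)+1$, then at least one of the following holds: (1) $\mathrm{rank}(M)\ge \mathrm{rank}(A)+1$; (2) there are two adjacent columns of $B$ with the same entries; (3) the final column of $B$ contains only zeroes.
   Context: All ranks are taken over $\mathbb{F}_2$. A $\{0,1\}$-matrix is a staircase matrix if its entries are non-decreasing down each column and non-increasing along each row (so its 1s form a staircase in the bottom left). -}

module Defs where

open import Data.Bool using (Bool; true; false; _∧_; _xor_) renaming (_≤_ to _≤ᵇ_)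
open import Data.Nat using (ℕ; zero; suc; _+_)
open import Data.Fin using (Fin; zero; suc; toℕ; splitAt) renaming (_≤_ to _≤ᶠ_)
open import Data.Sum using (_⊎_; inj₁; inj₂)
open import Data.Product using (Σ; ∃; _×_; _,_)
open import Relation.Binary.PropositionalEquality using (_≡_)
open import Relation.Nullary using (¬_)
open import Function.Definitions using (Injective)

-- Matrices over F₂ = Bool (false = 0, true = 1), entries indexed by (row, column).
Mat : ℕ → ℕ → Set
Mat n m = Fin n → Fin m → Bool

⊕ : ∀ {k} → (Fin k → Bool) → Bool
⊕ {zero}  f = false
⊕ {suc k} f = f zero xor ⊕ (λ i → f (suc i))

colComb : ∀ {n m k} → Mat n m → (Fin k → Fin m) → (Fin k → Bool) → Fin n → Bool
colComb M f c i = ⊕ (λ t → c t ∧ M i (f t))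

IndepCols : ∀ {n m k} → Mat n m → (Fin k → Fin m) → Set
IndepCols M f =
  Injective _≡_ _≡_ f ×
  (∀ c → (∀ i → colComb M f c i ≡ false) → ∀ t → c t ≡ false)

IsRank : ∀ {n m} → Mat n m → ℕ → Set
IsRank {n} {m} M r =
  (Σ (Fin r → Fin m) λ f → IndepCols M f) ×
  (¬ Σ (Fin (suc r) → Fin m) λ f → IndepCols M f)

SymMat : ∀ {n} → Mat n n → Set
SymMat A = ∀ i j → A i j ≡ A j i

Staircase : ∀ {n m} → Mat n m → Set
Staircase C =
  (∀ i i' j → i ≤ᶠ i' → C i j ≤ᵇ C i' j) ×
  (∀ i j j' → j ≤ᶠ j' → C i j' ≤ᵇ C i j)

block : ∀ {n m} → Mat n n → Mat m m → Mat n m → Mat (n + m) (n + m)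
block {n} A B C i j with splitAt n i | splitAt n j
... | inj₁ a | inj₁ b = A a b
... | inj₁ a | inj₂ b = C a b
... | inj₂ a | inj₁ b = C b a
... | inj₂ a | inj₂ b = B a b

AdjEqualCols : ∀ {m} → Mat m m → Set
AdjEqualCols {m} B =
  Σ (Fin m) λ j → Σ (Fin m) λ j' → (toℕ j' ≡ suc (toℕ j)) × (∀ i → B i j ≡ B i j')

LastColZero : ∀ {m} → Mat m m → Set
LastColZero {m} B = ∀ j → suc (toℕ j) ≡ m → ∀ i → B i j ≡ false

-- Let f pick r independent columns of A and suppose rank M ≤ r. The columns f t of M are still
-- independent, so every column of the right block [C; B] is a combination of them. The top rows
-- force the coefficients to be the unique ones expressing the column of C through the columns of
-- A; the bottom rows (Cᵀ next to B) then express the column of B with the same coefficients.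
-- Hence equal adjacent columns of C give equal adjacent columns of B, and a zero last column of C
-- gives a zero last column of B. In the remaining case, since the rows of C are non-increasing,
-- every column j of C has a row with a 1 at j and 0s to its right; this makes the first r+1
-- columns of [C; B] triangular, hence independent, contradicting rank M ≤ r.

module Submission where

open import Defs
open import Data.Nat using (ℕ; suc; _≤_)
open import Data.Sum using (_⊎_)

open import Algebra.Bundles using (CommutativeRing)
open import Data.Bool using (Bool; true; false; _∧_; _xor_; f≤t; b≤b) renaming (_≤_ to _≤ᵇ_)
open import Data.Bool.Properties
  using (∧-identityʳ; ∧-zeroʳ; ∧-distribʳ-xor; xor-identityʳ; xor-same; xor-∧-commutativeRing;
         ¬-not; ≤-antisym; ≤-minimum)
  renaming (_≟_ to _≟ᵇ_)
open import Algebra.Properties.CommutativeSemigroup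
  (CommutativeRing.+-commutativeSemigroup xor-∧-commutativeRing) using (interchange)
open import Data.Empty using (⊥-elim)
open import Data.Fin using (Fin; zero; suc; toℕ; _↑ˡ_; _↑ʳ_; inject₁; inject≤; fromℕ)
  renaming (_≤_ to _≤ᶠ_; _<_ to _<ᶠ_)
open import Data.Fin.Properties
  using (splitAt-↑ˡ; splitAt-↑ʳ; ↑ˡ-injective; toℕ-injective; toℕ-fromℕ;
         toℕ-inject₁; toℕ-inject≤; <-cmp; all?; any?; ¬∀⟶∃¬; ≤fromℕ; ≤̄⇒inject₁<)
  renaming (suc-injective to Fin-suc-injective)
open import Data.Fin.Relation.Unary.Top using (view; ‵fromℕ; ‵inject₁)
open import Data.Fin.Subset.Properties using (anySubset?)
open import Data.Nat.Properties using (_≤?_; ≰⇒>; ≤⇒≤′; <⇒≤; <⇒≱; ≤-refl; suc-injective)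
import Data.Nat as ℕ
open import Data.Product using (Σ; _,_; proj₁; proj₂; _×_)
open import Data.Sum using (inj₁; inj₂)
open import Data.Vec using (lookup; tabulate)
open import Data.Vec.Properties using (lookup∘tabulate)
open import Data.Vec.Functional using (_∷_; tail)
open import Function using (_∘_)
open import Relation.Binary using (tri<; tri≈; tri>)
open import Relation.Binary.PropositionalEquality
open import Relation.Nullary using (¬_; Dec; yes; no)

⊕-cong : ∀ {k} {h h' : Fin k → Bool} → (∀ t → h t ≡ h' t) → ⊕ h ≡ ⊕ h'
⊕-cong {ℕ.zero} e = refl
⊕-cong {suc k} e = cong₂ _xor_ (e zero) (⊕-cong (e ∘ suc))

⊕-false : ∀ {k} {h : Fin k → Bool} → (∀ t → h t ≡ false) → ⊕ h ≡ false
⊕-false {ℕ.zero} e = refl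
⊕-false {suc k} e rewrite e zero = ⊕-false (e ∘ suc)

⊕-xor : ∀ {k} (h h' : Fin k → Bool) → ⊕ (λ t → h t xor h' t) ≡ ⊕ h xor ⊕ h'
⊕-xor {ℕ.zero} h h' = refl
⊕-xor {suc k} h h' = trans (cong ((h zero xor h' zero) xor_) (⊕-xor (h ∘ suc) (h' ∘ suc)))
                           (interchange (h zero) (h' zero) (⊕ (h ∘ suc)) (⊕ (h' ∘ suc)))

indicator : ∀ {k} → Fin k → Fin k → Bool
indicator zero    zero    = true
indicator zero    (suc _) = false
indicator (suc t) zero    = false
indicator (suc t) (suc u) = indicator t u

⊕-indicator : ∀ {k} (t : Fin k) (h : Fin k → Bool) → ⊕ (λ u → indicator t u ∧ h u) ≡ h t
⊕-indicator zero    h = trans (cong (h zero xor_) (⊕-false {h = λ u → false ∧ h (suc u)} (λ _ → refl)))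
                              (xor-identityʳ _)
⊕-indicator (suc t) h = ⊕-indicator t (h ∘ suc)

xor≡false⇒≡ : ∀ {a b} → a xor b ≡ false → a ≡ b
xor≡false⇒≡ {false} {false} _ = refl
xor≡false⇒≡ {true}  {true}  _ = refl

module _ {n m : ℕ} (M : Mat n m) where

  colComb-cong : ∀ {k} (f : Fin k → Fin m) {c c' : Fin k → Bool} →
    (∀ t → c t ≡ c' t) → ∀ i → colComb M f c i ≡ colComb M f c' i
  colComb-cong f e i = ⊕-cong (λ t → cong (_∧ M i (f t)) (e t))

  colComb-xor : ∀ {k} (f : Fin k → Fin m) (c c' : Fin k → Bool) i →
    colComb M f (λ t → c t xor c' t) i ≡ colComb M f c i xor colComb M f c' i
  colComb-xor f c c' i = trans (⊕-cong (λ t → ∧-distribʳ-xor (M i (f t)) (c t) (c' t)))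
                               (⊕-xor (λ t → c t ∧ M i (f t)) (λ t → c' t ∧ M i (f t)))

  colComb-tail : ∀ {k} (f : Fin (suc k) → Fin m) (c : Fin (suc k) → Bool) → c zero ≡ false →
    ∀ i → colComb M f c i ≡ colComb M (tail f) (tail c) i
  colComb-tail f c c₀≡false i rewrite c₀≡false = refl

  indepCols-tail : ∀ {k} {f : Fin (suc k) → Fin m} → IndepCols M f → IndepCols M (tail f)
  indepCols-tail (inj , ind) =
    (λ e → Fin-suc-injective (inj e)) ,
    (λ c eq t → ind (false ∷ c) eq (suc t))

  indepCols-shrink : ∀ {k l} → k ℕ.≤′ l →
    Σ (Fin l → Fin m) (IndepCols M) → Σ (Fin k → Fin m) (IndepCols M)
  indepCols-shrink ℕ.≤′-refl     fam         = fam
  indepCols-shrink (ℕ.≤′-step p) (f , indf) = indepCols-shrink p (tail f , indepCols-tail indf)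

  rank-maximal : ∀ {s k} → IsRank M s → Σ (Fin k → Fin m) (IndepCols M) → k ≤ s
  rank-maximal {s} {k} (_ , noLarger) fam with k ≤? s
  ... | yes k≤s = k≤s
  ... | no  k≰s = ⊥-elim (noLarger (indepCols-shrink (≤⇒≤′ (≰⇒> k≰s)) fam))

  indepCols-unique-coeffs : ∀ {k} {f : Fin k → Fin m} → IndepCols M f → ∀ c c' →
    (∀ i → colComb M f c i ≡ colComb M f c' i) → ∀ t → c t ≡ c' t
  indepCols-unique-coeffs (_ , ind) c c' eq t =
    xor≡false⇒≡ (ind (λ t → c t xor c' t)
      (λ i → trans (colComb-xor _ c c' i) (trans (cong (_xor _) (eq i)) (xor-same (colComb M _ c' i)))) t)

  InSpan : ∀ {k} → (Fin k → Fin m) → Fin m → Set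
  InSpan {k} f x = Σ (Fin k → Bool) λ c → ∀ i → colComb M f c i ≡ M i x

  inSpan? : ∀ {k} (f : Fin k → Fin m) x → Dec (InSpan f x)
  inSpan? f x with anySubset? (λ s → all? (λ i → colComb M f (lookup s) i ≟ᵇ M i x))
  ... | yes (s , p) = yes (lookup s , p)
  ... | no ¬p = no λ (c , p) →
    ¬p (tabulate c , λ i → trans (colComb-cong f (lookup∘tabulate c) i) (p i))

  indepCols-extend : ∀ {k} {f : Fin k → Fin m} {x} →
    IndepCols M f → ¬ InSpan f x → IndepCols M (x ∷ f)
  indepCols-extend {f = f} {x} (injf , indf) x∉span = inj , ind
    where
    x≢col : ∀ t → x ≢ f t
    x≢col t x≡ft = x∉span (indicator t , λ i →
      trans (⊕-indicator t (λ u → M i (f u))) (cong (M i) (sym x≡ft)))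

    inj : ∀ {a b} → (x ∷ f) a ≡ (x ∷ f) b → a ≡ b
    inj {zero}  {zero}  _ = refl
    inj {zero}  {suc u} e = ⊥-elim (x≢col u e)
    inj {suc t} {zero}  e = ⊥-elim (x≢col t (sym e))
    inj {suc t} {suc u} e = cong suc (injf e)

    -- If the coefficient of x were 1, the remaining terms would express x in the span of f.
    head-false : ∀ c → (∀ i → colComb M (x ∷ f) c i ≡ false) → c zero ≡ false
    head-false c eq with c zero in c₀
    ... | false = refl
    ... | true  = ⊥-elim (x∉span (tail c , λ i → sym (xor≡false⇒≡ (eq i))))

    ind : ∀ c → (∀ i → colComb M (x ∷ f) c i ≡ false) → ∀ t → c t ≡ false
    ind c eq zero    = head-false c eq
    ind c eq (suc t) =
      indf (tail c) (λ i → trans (sym (colComb-tail (x ∷ f) c (head-false c eq) i)) (eq i)) t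

  triangular⇒independent : ∀ {k} (f : Fin k → Fin m) (w : Fin k → Fin n) →
    (∀ t → M (w t) (f t) ≡ true) → (∀ t u → t <ᶠ u → M (w t) (f u) ≡ false) →
    ∀ c → (∀ i → colComb M f c i ≡ false) → ∀ t → c t ≡ false
  triangular⇒independent {ℕ.zero} f w pivot below c eq ()
  triangular⇒independent {suc k}  f w pivot below c eq = ind
    where
    later-zero : ∀ t → c (suc t) ∧ M (w zero) (f (suc t)) ≡ false
    later-zero t = trans (cong (c (suc t) ∧_) (below zero (suc t) (ℕ.s≤s ℕ.z≤n))) (∧-zeroʳ _)

    first-pivot-row : colComb M f c (w zero) ≡ c zero
    first-pivot-row = begin
      (c zero ∧ M (w zero) (f zero)) xor ⊕ (λ t → c (suc t) ∧ M (w zero) (f (suc t)))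
        ≡⟨ cong₂ (λ a b → (c zero ∧ a) xor b) (pivot zero) (⊕-false later-zero) ⟩
      (c zero ∧ true) xor false
        ≡⟨ trans (xor-identityʳ _) (∧-identityʳ _) ⟩
      c zero ∎
      where open ≡-Reasoning

    head-false : c zero ≡ false
    head-false = trans (sym first-pivot-row) (eq (w zero))

    ind : ∀ t → c t ≡ false
    ind zero    = head-false
    ind (suc t) = triangular⇒independent (tail f) (tail w) (pivot ∘ suc)
      (λ t u t<u → below (suc t) (suc u) (ℕ.s≤s t<u))
      (tail c) (λ i → trans (sym (colComb-tail f c head-false i)) (eq i)) t

  triangular⇒indepCols : ∀ {k} (f : Fin k → Fin m) (w : Fin k → Fin n) →
    (∀ t → M (w t) (f t) ≡ true) → (∀ t u → t <ᶠ u → M (w t) (f u) ≡ false) →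
    IndepCols M f
  triangular⇒indepCols f w pivot below = inj , triangular⇒independent f w pivot below
    where
    distinct : ∀ {a b} → a <ᶠ b → f a ≢ f b
    distinct {a} {b} a<b e with trans (sym (pivot a)) (trans (cong (M (w a)) e) (below a b a<b))
    ... | ()

    inj : ∀ {a b} → f a ≡ f b → a ≡ b
    inj {a} {b} e with <-cmp a b
    ... | tri< a<b _ _ = ⊥-elim (distinct a<b e)
    ... | tri≈ _ a≡b _ = a≡b
    ... | tri> _ _ b<a = ⊥-elim (distinct b<a (sym e))

≤ᵇ-≢⇒true-false : ∀ {a b} → b ≤ᵇ a → a ≢ b → a ≡ true × b ≡ false
≤ᵇ-≢⇒true-false f≤t _   = refl , refl
≤ᵇ-≢⇒true-false b≤b a≢a = ⊥-elim (a≢a refl)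

RowsNonIncreasing : ∀ {n m} → Mat n m → Set
RowsNonIncreasing C = ∀ i j j' → j ≤ᶠ j' → C i j' ≤ᵇ C i j

PivotRow : ∀ {n m} → Mat n m → Fin m → Set
PivotRow {n} C j = Σ (Fin n) λ i → C i j ≡ true × (∀ j' → j <ᶠ j' → C i j' ≡ false)

module _ {n m' : ℕ} (C : Mat n (suc m')) (rowsNonIncreasing : RowsNonIncreasing C) where

  pivotRow-last : ¬ (∀ i → C i (fromℕ m') ≡ false) → PivotRow C (fromℕ m')
  pivotRow-last lastNonzero with ¬∀⟶∃¬ n _ (λ i → C i (fromℕ m') ≟ᵇ false) lastNonzero
  ... | i , Cij≢false = i , ¬-not Cij≢false , λ j' last<j' → ⊥-elim (<⇒≱ last<j' (≤fromℕ j'))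

  pivotRow-step : ∀ j → ¬ (∀ i → C i (inject₁ j) ≡ C i (suc j)) → PivotRow C (inject₁ j)
  pivotRow-step j differ with ¬∀⟶∃¬ n _ (λ i → C i (inject₁ j) ≟ᵇ C i (suc j)) differ
  ... | i , ne with ≤ᵇ-≢⇒true-false (rowsNonIncreasing i _ _ (<⇒≤ (≤̄⇒inject₁< ≤-refl))) ne
  ...   | Cij≡true , Cij+1≡false = i , Cij≡true , later-zero
    where
    later-zero : ∀ j' → inject₁ j <ᶠ j' → C i j' ≡ false
    later-zero j' j<j' =
      ≤-antisym (subst (C i j' ≤ᵇ_) Cij+1≡false (rowsNonIncreasing i (suc j) j' j+1≤j')) (≤-minimum _)
      where
      j+1≤j' : suc j ≤ᶠ j'
      j+1≤j' = subst (ℕ._≤ toℕ j') (cong suc (toℕ-inject₁ j)) j<j'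

  staircase-cases :
    (Σ (Fin m') λ j → ∀ i → C i (inject₁ j) ≡ C i (suc j)) ⊎
    (∀ i → C i (fromℕ m') ≡ false) ⊎
    (∀ j → PivotRow C j)
  staircase-cases with any? (λ j → all? (λ i → C i (inject₁ j) ≟ᵇ C i (suc j)))
  ... | yes adjacentEqual = inj₁ adjacentEqual
  ... | no noAdjacentEqual with all? (λ i → C i (fromℕ m') ≟ᵇ false)
  ...   | yes lastZero = inj₂ (inj₁ lastZero)
  ...   | no lastNonzero = inj₂ (inj₂ pivot)
    where
    pivot : ∀ j → PivotRow C j
    pivot j with view j
    ... | ‵fromℕ      = pivotRow-last lastNonzero
    ... | ‵inject₁ j₀ = pivotRow-step j₀ (λ eq → noAdjacentEqual (j₀ , eq))

module _ {n m : ℕ} (A : Mat n n) (B : Mat m m) (C : Mat n m) where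

  block-↑ˡ-↑ˡ : ∀ i j → block A B C (i ↑ˡ m) (j ↑ˡ m) ≡ A i j
  block-↑ˡ-↑ˡ i j rewrite splitAt-↑ˡ n i m | splitAt-↑ˡ n j m = refl

  block-↑ˡ-↑ʳ : ∀ i j → block A B C (i ↑ˡ m) (n ↑ʳ j) ≡ C i j
  block-↑ˡ-↑ʳ i j rewrite splitAt-↑ˡ n i m | splitAt-↑ʳ n m j = refl

  block-↑ʳ-↑ˡ : ∀ i j → block A B C (n ↑ʳ i) (j ↑ˡ m) ≡ C j i
  block-↑ʳ-↑ˡ i j rewrite splitAt-↑ʳ n m i | splitAt-↑ˡ n j m = refl

  block-↑ʳ-↑ʳ : ∀ i j → block A B C (n ↑ʳ i) (n ↑ʳ j) ≡ B i j
  block-↑ʳ-↑ʳ i j rewrite splitAt-↑ʳ n m i | splitAt-↑ʳ n m j = refl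

module LowRank {n m' : ℕ} (A : Mat n n) (B : Mat (suc m') (suc m')) (C : Mat n (suc m'))
  {r : ℕ} (f : Fin r → Fin n) (indf : IndepCols A f)
  (noLarger : ¬ Σ (Fin (suc r) → Fin (n ℕ.+ suc m')) (IndepCols (block A B C))) where

  private
    m : ℕ
    m = suc m'

    M : Mat (n ℕ.+ m) (n ℕ.+ m)
    M = block A B C

  leftCols : Fin r → Fin (n ℕ.+ m)
  leftCols t = f t ↑ˡ m

  leftCols-indep : IndepCols M leftCols
  leftCols-indep =
    (λ e → proj₁ indf (↑ˡ-injective m _ _ e)) ,
    (λ c eq → proj₂ indf c (λ i →
      trans (⊕-cong (λ t → cong (c t ∧_) (sym (block-↑ˡ-↑ˡ A B C i (f t))))) (eq (i ↑ˡ m))))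

  rightCol-inSpan : ∀ j → InSpan M leftCols (n ↑ʳ j)
  rightCol-inSpan j with inSpan? M leftCols (n ↑ʳ j)
  ... | yes inSpan = inSpan
  ... | no  x∉span = ⊥-elim (noLarger (_ , indepCols-extend M leftCols-indep x∉span))

  coeffs : Fin m → Fin r → Bool
  coeffs j = proj₁ (rightCol-inSpan j)

  coeffs-top : ∀ j i → colComb A f (coeffs j) i ≡ C i j
  coeffs-top j i = begin
    colComb A f (coeffs j) i
      ≡⟨ ⊕-cong (λ t → cong (coeffs j t ∧_) (sym (block-↑ˡ-↑ˡ A B C i (f t)))) ⟩
    colComb M leftCols (coeffs j) (i ↑ˡ m)
      ≡⟨ proj₂ (rightCol-inSpan j) (i ↑ˡ m) ⟩
    M (i ↑ˡ m) (n ↑ʳ j)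
      ≡⟨ block-↑ˡ-↑ʳ A B C i j ⟩
    C i j ∎
    where open ≡-Reasoning

  coeffs-bottom : ∀ j i → ⊕ (λ t → coeffs j t ∧ C (f t) i) ≡ B i j
  coeffs-bottom j i = begin
    ⊕ (λ t → coeffs j t ∧ C (f t) i)
      ≡⟨ ⊕-cong (λ t → cong (coeffs j t ∧_) (sym (block-↑ʳ-↑ˡ A B C i (f t)))) ⟩
    colComb M leftCols (coeffs j) (n ↑ʳ i)
      ≡⟨ proj₂ (rightCol-inSpan j) (n ↑ʳ i) ⟩
    M (n ↑ʳ i) (n ↑ʳ j)
      ≡⟨ block-↑ʳ-↑ʳ A B C i j ⟩
    B i j ∎
    where open ≡-Reasoning

  B-cols-≡ : ∀ {j j'} → (∀ i → C i j ≡ C i j') → ∀ i → B i j ≡ B i j'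
  B-cols-≡ {j} {j'} Cj≡Cj' i = begin
    B i j                              ≡⟨ sym (coeffs-bottom j i) ⟩
    ⊕ (λ t → coeffs j t ∧ C (f t) i)   ≡⟨ ⊕-cong (λ t → cong (_∧ C (f t) i) (same-coeffs t)) ⟩
    ⊕ (λ t → coeffs j' t ∧ C (f t) i)  ≡⟨ coeffs-bottom j' i ⟩
    B i j'                             ∎
    where
    open ≡-Reasoning
    same-coeffs : ∀ t → coeffs j t ≡ coeffs j' t
    same-coeffs = indepCols-unique-coeffs A indf (coeffs j) (coeffs j')
      (λ i → trans (coeffs-top j i) (trans (Cj≡Cj' i) (sym (coeffs-top j' i))))

  B-col-zero : ∀ {j} → (∀ i → C i j ≡ false) → ∀ i → B i j ≡ false
  B-col-zero {j} Cj≡0 i =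
    trans (sym (coeffs-bottom j i)) (⊕-false (λ t → cong (_∧ C (f t) i) (zero-coeffs t)))
    where
    zero-coeffs : ∀ t → coeffs j t ≡ false
    zero-coeffs = proj₂ indf (coeffs j) (λ i → trans (coeffs-top j i) (Cj≡0 i))

  ¬pivotRows : suc r ≤ m → ¬ (∀ j → PivotRow C j)
  ¬pivotRows r<m pivot = noLarger (cols , triangular⇒indepCols M cols rows on-pivot below-pivot)
    where
    col : Fin (suc r) → Fin m
    col t = inject≤ t r<m
    cols : Fin (suc r) → Fin (n ℕ.+ m)
    cols t = n ↑ʳ col t
    rows : Fin (suc r) → Fin (n ℕ.+ m)
    rows t = proj₁ (pivot (col t)) ↑ˡ m
    on-pivot : ∀ t → M (rows t) (cols t) ≡ true
    on-pivot t = trans (block-↑ˡ-↑ʳ A B C _ _) (proj₁ (proj₂ (pivot (col t))))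
    below-pivot : ∀ t u → t <ᶠ u → M (rows t) (cols u) ≡ false
    below-pivot t u t<u = trans (block-↑ˡ-↑ʳ A B C _ _) (proj₂ (proj₂ (pivot (col t))) (col u)
      (subst₂ ℕ._<_ (sym (toℕ-inject≤ t r<m)) (sym (toℕ-inject≤ u r<m)) t<u))

  adjEqual-or-lastZero : RowsNonIncreasing C → suc r ≤ m →
    AdjEqualCols B ⊎ LastColZero B
  adjEqual-or-lastZero rowsNonIncreasing r<m with staircase-cases C rowsNonIncreasing
  ... | inj₁ (j , Cj≡Cj+1)   =
    inj₁ (inject₁ j , suc j , cong suc (sym (toℕ-inject₁ j)) , B-cols-≡ Cj≡Cj+1)
  ... | inj₂ (inj₁ lastZero) = inj₂ λ j j-last → subst (λ j → ∀ i → B i j ≡ false)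
    (sym (toℕ-injective (trans (suc-injective j-last) (sym (toℕ-fromℕ m'))))) (B-col-zero lastZero)
  ... | inj₂ (inj₂ pivots)   = ⊥-elim (¬pivotRows r<m pivots)

lemma4p2 : ∀ {n m} (A : Mat n n) (B : Mat m m) (C : Mat n m) →
    SymMat A → SymMat B → Staircase C →
    (r : ℕ) → IsRank A r → suc r ≤ m →
    (s : ℕ) → IsRank (block A B C) s →
    suc r ≤ s ⊎ AdjEqualCols B ⊎ LastColZero B
lemma4p2 {m = ℕ.zero} _ _ _ _ _ _ _ _ () _ _
lemma4p2 {m = suc _} A B C _ _ (_ , rowsNonIncreasing) r ((f , indf) , _) r<m s rankM with suc r ≤? s
... | yes r<s = inj₁ r<s
... | no  r≮s = inj₂ (LowRank.adjEqual-or-lastZero A B C f indf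
                        (r≮s ∘ rank-maximal (block A B C) rankM) rowsNonIncreasing r<m)
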